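{- Let $A$ be a complete model and $B,C$ models such that $A$ and $B$ are strongly equivalent and $B\subsetneq C$. Then $C\succ A$, i.e. $C\succsim A$ and not $A\succsim C$.
   Context: A model of computation over a set $X$ is any set of functions $f:X\to X\cup\{\bot\}$, where $\bot$ denotes "undefined"; $B\subsetneq C$ entails that $B$ and $C$ are over the same set. Injections are extended by $\rho(\bot)=\bot$. $A\succsim_\rho B$ means: for every $g\in B$ there is $f\in A$ with $\rho\circ g=f\circ\rho$; $A\succsim B$ means $A\succsim_\rho B$ for some injection $\rho$. $A$ and $B$ are strongly equivalent if there are bijections $\pi,\tau$ with $A\succsim_\pi B$ and $B\succsim_\tau A$. A model $A$ is complete if for every model $M$ over $\mathrm{dom}\,A$ with $M\supseteq A$ and $A\succsim M$, we have $M=A$. -}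

module Defs where

open import Level using (0ℓ)
open import Data.Maybe using (Maybe; map)
open import Data.Product using (Σ; ∃; _×_; _,_)
open import Relation.Binary.PropositionalEquality using (_≡_)
open import Relation.Nullary using (¬_)
open import Function using (_∘_)
open import Function.Bundles using (_↣_; _⤖_; Injection; Bijection)

-- Partial functions X → X ∪ {⊥}, with ⊥ represented by nothing.
PFun : Set → Set
PFun X = X → Maybe X

_≗ₚ_ : {X : Set} → PFun X → PFun X → Set
f ≗ₚ g = ∀ x → f x ≡ g x

-- Sets of functions are represented by predicates that respect function
-- equality (extensionality), since Agda lacks function extensionality.
record Model (X : Set) : Set₁ where
  field
    _∋_  : PFun X → Set
    resp : ∀ {f g} → f ≗ₚ g → _∋_ f → _∋_ g
open Model public

_⊆ₘ_ : {X : Set} → Model X → Model X → Set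
B ⊆ₘ C = ∀ g → B ∋ g → C ∋ g

_≡ₘ_ : {X : Set} → Model X → Model X → Set
B ≡ₘ C = (B ⊆ₘ C) × (C ⊆ₘ B)

_⊊ₘ_ : {X : Set} → Model X → Model X → Set
B ⊊ₘ C = (B ⊆ₘ C) × (∃ λ g → (C ∋ g) × ¬ (B ∋ g))

-- A ≿_ρ B for a map ρ : dom B → dom A (extended by ρ(⊥) = ⊥ via map):
-- for every g ∈ B there is f ∈ A with ρ ∘ g = f ∘ ρ.
Sim : {X Y : Set} → Model X → (Y → X) → Model Y → Set
Sim {X} {Y} A ρ B =
  ∀ g → B ∋ g → Σ (PFun X) λ f → (A ∋ f) × (∀ y → map ρ (g y) ≡ f (ρ y))

_≿_ : {X Y : Set} → Model X → Model Y → Set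
_≿_ {X} {Y} A B = Σ (Y ↣ X) λ ρ → Sim A (Injection.to ρ) B

StronglyEquivalent : {X Y : Set} → Model X → Model Y → Set
StronglyEquivalent {X} {Y} A B =
  Σ (Y ⤖ X) λ π → Σ (X ⤖ Y) λ τ → Sim A (Bijection.to π) B × Sim B (Bijection.to τ) A

Complete : {X : Set} → Model X → Set₁
Complete {X} A = (M : Model X) → A ⊆ₘ M → A ≿ M → M ≡ₘ A

_≻_ : {X Y : Set} → Model X → Model Y → Set
C ≻ A = (C ≿ A) × ¬ (A ≿ C)

-- Let τ : X → Y be a bijection with B ≿_τ A, so also C ≿_τ A.  If A ≿_ρ C,
-- then ρ ∘ τ simulates both A and the copy of C transported to X along τ.
-- A complete model contains every model that it simulates together with
-- itself along one injection, so the transported copy of C lies in A;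
-- transporting back along B ≿_τ A puts C inside B, contradicting B ⊊ C.
module Submission where

open import Defs
open import Data.Maybe using (map; just; nothing)
open import Data.Maybe.Properties using (map-∘)
open import Data.Product using (∃; _×_; _,_; proj₁)
open import Data.Sum using (_⊎_; inj₁; inj₂)
open import Relation.Binary.PropositionalEquality
  using (_≡_; refl; sym; trans; cong; module ≡-Reasoning)
open import Relation.Nullary using (¬_)
open import Function using (_∘_)
open import Function.Bundles using (_↣_; _⤖_; Injection; Bijection; Surjection)
open import Function.Construct.Composition using (_↣-∘_)

_∪ₘ_ : {X : Set} → Model X → Model X → Model X
A ∪ₘ B = record
  { _∋_  = λ f → (A ∋ f) ⊎ (B ∋ f)
  ; resp = λ { f≗g (inj₁ f∈A) → inj₁ (resp A f≗g f∈A)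
             ; f≗g (inj₂ f∈B) → inj₂ (resp B f≗g f∈B) } }

module _ {X Y Z : Set} {A : Model X} {B : Model Y} {C : Model Z} where

  Sim-∘ : {ρ : Y → X} {σ : Z → Y} → Sim A ρ B → Sim B σ C → Sim A (ρ ∘ σ) C
  Sim-∘ {ρ} {σ} A≿B B≿C h h∈C with B≿C h h∈C
  ... | g , g∈B , σh≡gσ with A≿B g g∈B
  ... | f , f∈A , ρg≡fρ = f , f∈A , λ z → begin
    map (ρ ∘ σ) (h z)   ≡⟨ map-∘ (h z) ⟩
    map ρ (map σ (h z)) ≡⟨ cong (map ρ) (σh≡gσ z) ⟩
    map ρ (g (σ z))     ≡⟨ ρg≡fρ (σ z) ⟩
    f (ρ (σ z))         ∎
    where open ≡-Reasoning

module _ {X Y : Set} {ρ : Y → X} where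

  Sim-monoˡ : {A A′ : Model X} {B : Model Y} → A ⊆ₘ A′ → Sim A ρ B → Sim A′ ρ B
  Sim-monoˡ A⊆A′ A≿B g g∈B with A≿B g g∈B
  ... | f , f∈A , ρg≡fρ = f , A⊆A′ f f∈A , ρg≡fρ

  Sim-∪ : {A : Model X} {B B′ : Model Y} → Sim A ρ B → Sim A ρ B′ → Sim A ρ (B ∪ₘ B′)
  Sim-∪ A≿B A≿B′ g (inj₁ g∈B)  = A≿B g g∈B
  Sim-∪ A≿B A≿B′ g (inj₂ g∈B′) = A≿B′ g g∈B′

Complete⇒⊇ : {X : Set} {A M : Model X} → Complete A →
  (ρ : X ↣ X) → Sim A (Injection.to ρ) A → Sim A (Injection.to ρ) M → M ⊆ₘ A
Complete⇒⊇ {A = A} {M} complete ρ A≿A A≿M g g∈M =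
  proj₁ (complete (A ∪ₘ M) (λ _ → inj₁) (ρ , A≿A∪M)) g (inj₂ g∈M)
  where
  A≿A∪M : Sim A (Injection.to ρ) (A ∪ₘ M)
  A≿A∪M = Sim-∪ {A = A} {A} {M} A≿A A≿M

module _ {X Y : Set} (τ : X ⤖ Y) where

  open Bijection τ using (to; to⁻; surjection)
  open Surjection surjection using (to∘to⁻)

  conjugate : PFun Y → PFun X
  conjugate g = map to⁻ ∘ g ∘ to

  map-to∘conjugate : ∀ g x → map to (conjugate g x) ≡ g (to x)
  map-to∘conjugate g x with g (to x)
  ... | just y  = cong just (to∘to⁻ y)
  ... | nothing = refl

  conjugates : Model Y → Model X
  conjugates C = record
    { _∋_  = λ h → ∃ λ g → (C ∋ g) × (h ≗ₚ conjugate g)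
    ; resp = λ { h≗h′ (g , g∈C , h≗g) → g , g∈C , λ x → trans (sym (h≗h′ x)) (h≗g x) } }

  Sim-conjugates : (C : Model Y) → Sim C to (conjugates C)
  Sim-conjugates C h (g , g∈C , h≗g) =
    g , g∈C , λ x → trans (cong (map to) (h≗g x)) (map-to∘conjugate g x)

  conjugate-reflects : (A : Model X) (B : Model Y) → Sim B to A →
    ∀ g → A ∋ conjugate g → B ∋ g
  conjugate-reflects A B B≿A g g∈A with B≿A (conjugate g) g∈A
  ... | g′ , g′∈B , τg≡g′τ = resp B g′≗g g′∈B
    where
    open ≡-Reasoning
    g′≗g : g′ ≗ₚ g
    g′≗g y = begin
      g′ y                          ≡⟨ cong g′ (sym (to∘to⁻ y)) ⟩
      g′ (to (to⁻ y))               ≡⟨ sym (τg≡g′τ (to⁻ y)) ⟩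
      map to (conjugate g (to⁻ y))  ≡⟨ map-to∘conjugate g (to⁻ y) ⟩
      g (to (to⁻ y))                ≡⟨ cong g (to∘to⁻ y) ⟩
      g y                           ∎

mainTheorem18 : {X Y : Set} (A : Model X) (B C : Model Y) →
    Complete A → StronglyEquivalent A B → B ⊊ₘ C → C ≻ A
mainTheorem18 {X} A B C complete (_ , τ , _ , B≿A) (B⊆C , g , g∈C , g∉B) =
  (Bijection.injection τ , C≿A) , A⋡C
  where
  C≿A : Sim C (Bijection.to τ) A
  C≿A = Sim-monoˡ {A = B} {C} {A} B⊆C B≿A

  A⋡C : ¬ (A ≿ C)
  A⋡C (ρ , A≿C) =
    g∉B (conjugate-reflects τ A B B≿A g (conjugates⊆A _ (g , g∈C , λ _ → refl)))
    where
    through-C : (D : Model X) →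
      Sim C (Bijection.to τ) D → Sim A (Injection.to ρ ∘ Bijection.to τ) D
    through-C D = Sim-∘ {A = A} {C} {D} A≿C

    conjugates⊆A : conjugates τ C ⊆ₘ A
    conjugates⊆A = Complete⇒⊇ {A = A} {conjugates τ C} complete (ρ ↣-∘ Bijection.injection τ)
      (through-C A C≿A) (through-C (conjugates τ C) (Sim-conjugates τ C))
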